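{- Let $n\ge 3$ be a prime and let $G$ be the graph defined in the context below. For each $l\in[n]$ let $P^l=\{v^l_{k,j}:k,j\in[n]\}$ and $P^l_k=\{v^l_{k,1},\dots,v^l_{k,n}\}$ for $k\in[n]$. Then for each $l\in[n]$, the subgraph $G^2[P^l]$ of $G^2$ induced by $P^l$ is isomorphic to the complete multipartite graph $K_{n*n}$ whose partite sets are $P^l_1,P^l_2,\dots,P^l_n$.
   Context: For a graph $H$, $H^2$ denotes the square of $H$: the graph on $V(H)$ in which two distinct vertices are adjacent iff their distance in $H$ is at most $2$. $K_{n*r}$ denotes the complete multipartite graph with $r$ partite sets each of size $n$. Write $[n]=\{1,\dots,n\}$. For $i\in[n-1]$ define $L_i(j,k)\in[n]$ for $j,k\in[n]$ by $L_i(j,k)\equiv j+i(k-1)\pmod n$ (the residue $0$ being represented by $n$). The graph $G$ has vertex set consisting of: vertices $v^l_{k,j}$ for $k,l,j\in[n]$; vertices $w_{i,j}$ and $u_{i,j}$ for $i\in[n-1]$, $j\in[n]$; and vertices $s_m$ for $m\in[n]$ (all distinct). For $l,m\in[n]$ let $T_{l,m}=\{v^l_{1,m},v^l_{2,m},\dots,v^l_{n,m}\}$. The edges of $G$ are exactly: - $w_{i,j}v^l_{k,L_i(j,k)}$ for all $i\in[n-1]$, $j,k,l\in[n]$; - $u_{i,j}y$ for all $i\in[n-1]$, $j\in[n]$ and all $y\in T_{l,L_i(j,l)}$ for some $l\in[n]$; - $s_m y$ for all $m\in[n]$ and all $y\in T_{l,m}$ for some $l\in[n]$. -}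

module Defs where

open import Data.Nat using (ℕ; suc; _+_; _*_; _∸_; NonZero)
open import Data.Nat.DivMod using (_mod_)
open import Data.Fin using (Fin; toℕ)
open import Data.Product using (Σ; _×_)
open import Data.Sum using (_⊎_)
open import Relation.Binary.PropositionalEquality using (_≡_; _≢_)

-- Conventions: [n] = {1,…,n} is represented by Fin n (value t ∈ Fin n stands
-- for t+1).  [n-1] is represented by Fin (n ∸ 1) (value t stands for t+1).

Square : {V : Set} → (V → V → Set) → V → V → Set
Square {V} E x y = x ≢ y × (E x y ⊎ Σ V (λ z → E x z × E z y))

CompleteMultipartite : {V P : Set} → (V → P) → V → V → Set
CompleteMultipartite part x y = part x ≢ part y

module _ (n : ℕ) .{{_ : NonZero n}} where

  -- L_i(j,k) ≡ j + i(k-1) (mod n); with 0-based j', k' and i = i'+1 this is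
  -- (j'+1) ≡ (j'+1) + (i'+1) k'  i.e.  j' + (i'+1) k' mod n (0-based).
  L : Fin (n ∸ 1) → Fin n → Fin n → Fin n
  L i j k = (toℕ j + suc (toℕ i) * toℕ k) mod n

  data Vertex : Set where
    v : (l k j : Fin n) → Vertex
    w : (i : Fin (n ∸ 1)) (j : Fin n) → Vertex
    u : (i : Fin (n ∸ 1)) (j : Fin n) → Vertex
    s : (m : Fin n) → Vertex

  data Edge : Vertex → Vertex → Set where
    wv : (i : Fin (n ∸ 1)) (j k l : Fin n) → Edge (w i j) (v l k (L i j k))
    uv : (i : Fin (n ∸ 1)) (j l k : Fin n) → Edge (u i j) (v l k (L i j l))
    sv : (m l k : Fin n) → Edge (s m) (v l k m)

  Adj : Vertex → Vertex → Set
  Adj x y = Edge x y ⊎ Edge y x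

  Adj² : Vertex → Vertex → Set
  Adj² = Square Adj

-- Same level l, same part k: every neighbour of v^l_{k,j} in G determines j
-- from k (a w-vertex by its line, a u- or s-vertex outright), and there are
-- no edges between v-vertices, so distinct vertices of one part are at
-- distance at least 3.  Different parts k ≠ k′: for j = j′ the vertex s_j is
-- a common neighbour; for j ≠ j′ the two points (k, j) and (k′, j′) of the
-- affine plane over ℤ/n lie on a unique line c + t·x with nonzero slope t,
-- because n is prime, and w_{t,c} is a common neighbour.
module Submission where

open import Defs
open import Data.Nat using (ℕ; _≤_; NonZero)
open import Data.Nat.Primality using (Prime)
open import Data.Fin using (Fin)
open import Data.Product using (_×_; _,_; proj₁)
open import Function.Bundles using (_⇔_)

open import Level using (0ℓ)
open import Data.Nat using (suc; _+_; _*_; _∸_; _<_; _%_; >-nonZero⁻¹)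
open import Data.Nat.Properties
  using (+-identityʳ; +-assoc; +-comm; *-comm; *-assoc; *-identityˡ; n≢0⇒n>0; ∸-monoˡ-≤)
open import Data.Nat.DivMod
  using (_mod_; m%n%n≡m%n; m<n⇒m%n≡m; m%n<n; %-distribˡ-+; %-distribˡ-*; m*n%n≡0)
open import Data.Nat.Divisibility using (n∣m⇒m%n≡0)
open import Data.Nat.Coprimality using (Coprime; coprime-Bézout)
open import Data.Nat.GCD using (module Bézout)
open import Data.Nat.Primality using (prime⇒irreducible)
open import Data.Nat.Tactic.RingSolver using (solve-∀)
open import Data.Fin using (toℕ; fromℕ<; _≟_)
open import Data.Fin.Properties using (toℕ-fromℕ<; toℕ-injective; toℕ<n)
open import Data.Product using (∃; ∃₂; proj₂)
open import Data.Sum using (inj₁; inj₂)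
open import Data.Empty using (⊥-elim)
open import Function.Bundles using (mk⇔)
open import Function.Base using (_∘_)
open import Relation.Nullary using (¬_; Dec; yes; no)
open import Relation.Binary.Bundles using (Setoid)
open import Relation.Binary.PropositionalEquality
  using (_≡_; _≢_; refl; sym; trans; cong; cong₂; subst; module ≡-Reasoning)
import Relation.Binary.PropositionalEquality as ≡
import Relation.Binary.Construct.On as On
import Relation.Binary.Reasoning.Setoid as SetoidReasoning

module Modular (n : ℕ) .{{_ : NonZero n}} where

  infix 4 _≋_
  infix 8 -_

  _≋_ : ℕ → ℕ → Set
  a ≋ b = a % n ≡ b % n

  ≋-setoid : Setoid 0ℓ 0ℓ
  ≋-setoid = On.setoid (≡.setoid ℕ) (_% n)

  open Setoid ≋-setoid public using ()
    renaming (refl to ≋-refl; sym to ≋-sym; trans to ≋-trans; reflexive to ≡⇒≋)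

  %-≋ : ∀ a → a % n ≋ a
  %-≋ a = m%n%n≡m%n a n

  +-cong : ∀ {a b c d} → a ≋ b → c ≋ d → a + c ≋ b + d
  +-cong {a} {b} {c} {d} a≋b c≋d = begin
    (a + c) % n               ≡⟨ %-distribˡ-+ a c n ⟩
    (a % n + c % n) % n       ≡⟨ cong₂ (λ x y → (x + y) % n) a≋b c≋d ⟩
    (b % n + d % n) % n       ≡⟨ %-distribˡ-+ b d n ⟨
    (b + d) % n               ∎
    where open ≡-Reasoning

  *-cong : ∀ {a b c d} → a ≋ b → c ≋ d → a * c ≋ b * d
  *-cong {a} {b} {c} {d} a≋b c≋d = begin
    (a * c) % n               ≡⟨ %-distribˡ-* a c n ⟩
    (a % n * (c % n)) % n     ≡⟨ cong₂ (λ x y → (x * y) % n) a≋b c≋d ⟩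
    (b % n * (d % n)) % n     ≡⟨ %-distribˡ-* b d n ⟨
    (b * d) % n               ∎
    where open ≡-Reasoning

  +-congˡ : ∀ a {b c} → b ≋ c → a + b ≋ a + c
  +-congˡ a = +-cong (≋-refl {a})

  +-congʳ : ∀ {a b} c → a ≋ b → a + c ≋ b + c
  +-congʳ c a≋b = +-cong a≋b (≋-refl {c})

  *-congˡ : ∀ a {b c} → b ≋ c → a * b ≋ a * c
  *-congˡ a = *-cong (≋-refl {a})

  *-congʳ : ∀ {a b} c → a ≋ b → a * c ≋ b * c
  *-congʳ c a≋b = *-cong a≋b (≋-refl {c})

  ≋⇒≡ : ∀ {a b} → a < n → b < n → a ≋ b → a ≡ b
  ≋⇒≡ a<n b<n a≋b = trans (sym (m<n⇒m%n≡m a<n)) (trans a≋b (m<n⇒m%n≡m b<n))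

  0%n≡0 : 0 % n ≡ 0
  0%n≡0 = m<n⇒m%n≡m (>-nonZero⁻¹ n)

  *n≋0 : ∀ a → a * n ≋ 0
  *n≋0 a = trans (m*n%n≡0 a n) (sym 0%n≡0)

  -- The additive inverse modulo n, kept inside ℕ so that no truncated
  -- subtraction ever occurs.
  -_ : ℕ → ℕ
  - a = (n ∸ 1) * a

  +-inverseʳ : ∀ a → a + - a ≋ 0
  +-inverseʳ a = ≋-trans (≡⇒≋ (a+[m∸1]*a≡a*m n a)) (*n≋0 a)
    where
    a+[m∸1]*a≡a*m : ∀ m .{{_ : NonZero m}} a → a + (m ∸ 1) * a ≡ a * m
    a+[m∸1]*a≡a*m (suc m) a = *-comm (suc m) a

  -‿+-cancelʳ : ∀ a b → a + - b + b ≋ a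
  -‿+-cancelʳ a b = begin
    a + - b + b     ≡⟨ +-assoc a (- b) b ⟩
    a + (- b + b)   ≡⟨ cong (a +_) (+-comm (- b) b) ⟩
    a + (b + - b)   ≈⟨ +-congˡ a (+-inverseʳ b) ⟩
    a + 0           ≡⟨ +-identityʳ a ⟩
    a               ∎
    where open SetoidReasoning ≋-setoid

  +-cancelʳ : ∀ {a b} c → a + c ≋ b + c → a ≋ b
  +-cancelʳ {a} {b} c a+c≋b+c = begin
    a               ≈⟨ -‿+-cancelʳ a c ⟨
    a + - c + c     ≡⟨ shift a ⟩
    a + c + - c     ≈⟨ +-congʳ (- c) a+c≋b+c ⟩
    b + c + - c     ≡⟨ shift b ⟨
    b + - c + c     ≈⟨ -‿+-cancelʳ b c ⟩
    b               ∎
    where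
    open SetoidReasoning ≋-setoid
    shift : ∀ x → x + - c + c ≡ x + c + - c
    shift x = trans (+-assoc x (- c) c)
                    (trans (cong (x +_) (+-comm (- c) c)) (sym (+-assoc x c (- c))))

  difference≋0⇒≋ : ∀ {a b} → a + - b ≋ 0 → a ≋ b
  difference≋0⇒≋ {a} {b} a-b≋0 = ≋-trans (≋-sym (-‿+-cancelʳ a b)) (+-congʳ b a-b≋0)

  ≉0⇒coprime : Prime n → ∀ {d} → ¬ d ≋ 0 → Coprime d n
  ≉0⇒coprime p {d} d≉0 {i} (i∣d , i∣n) with prime⇒irreducible p i∣n
  ... | inj₁ i≡1 = i≡1
  ... | inj₂ refl = ⊥-elim (d≉0 (trans (n∣m⇒m%n≡0 d n i∣d) (sym 0%n≡0)))

  *-inverse : Prime n → ∀ {d} → ¬ d ≋ 0 → ∃ λ a → a * d ≋ 1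
  *-inverse p {d} d≉0 with coprime-Bézout (≉0⇒coprime p d≉0)
  ... | Bézout.+- x y 1+y*n≡x*d = x , (begin
    x * d           ≡⟨ 1+y*n≡x*d ⟨
    1 + y * n       ≈⟨ +-congˡ 1 (*n≋0 y) ⟩
    1 + 0           ≡⟨ +-identityʳ 1 ⟩
    1               ∎)
    where open SetoidReasoning ≋-setoid
  ... | Bézout.-+ x y 1+x*d≡y*n = - x , +-cancelʳ (x * d) (begin
    - x * d + x * d   ≡⟨ cong (_+ x * d) (*-assoc (n ∸ 1) x d) ⟩
    - (x * d) + x * d ≡⟨ +-comm (- (x * d)) (x * d) ⟩
    x * d + - (x * d) ≈⟨ +-inverseʳ (x * d) ⟩
    0                 ≈⟨ *n≋0 y ⟨
    y * n             ≡⟨ 1+x*d≡y*n ⟨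
    1 + x * d         ∎)
    where open SetoidReasoning ≋-setoid

  -- The slope is t = (k − k′)⁻¹ (j − j′), reduced mod n.
  ∃-slope : Prime n → ∀ {k k′ j j′} → ¬ k ≋ k′ → ¬ j ≋ j′
          → ∃ λ t → 0 < t × t < n × t * k + j′ ≋ t * k′ + j
  ∃-slope p {k} {k′} {j} {j′} k≉k′ j≉j′ =
    t , n≢0⇒n>0 t≢0 , m%n<n (a * e) n , slope
    where
    open SetoidReasoning ≋-setoid
    d e : ℕ
    d = k + - k′
    e = j + - j′
    inverse : ∃ λ a → a * d ≋ 1
    inverse = *-inverse p (k≉k′ ∘ difference≋0⇒≋)
    a t : ℕ
    a = proj₁ inverse
    t = (a * e) % n
    t*d≋e : t * d ≋ e
    t*d≋e = begin
      t * d         ≈⟨ *-congʳ d (%-≋ (a * e)) ⟩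
      a * e * d     ≡⟨ *-assoc a e d ⟩
      a * (e * d)   ≡⟨ cong (a *_) (*-comm e d) ⟩
      a * (d * e)   ≡⟨ *-assoc a d e ⟨
      a * d * e     ≈⟨ *-congʳ e (proj₂ inverse) ⟩
      1 * e         ≡⟨ *-identityˡ e ⟩
      e             ∎
    t≢0 : t ≢ 0
    t≢0 t≡0 = j≉j′ (begin
      j             ≈⟨ -‿+-cancelʳ j j′ ⟨
      e + j′        ≈⟨ +-congʳ j′ t*d≋e ⟨
      t * d + j′    ≡⟨ cong (λ s → s * d + j′) t≡0 ⟩
      j′            ∎)
    slope : t * k + j′ ≋ t * k′ + j
    slope = begin
      t * k + j′              ≈⟨ +-congʳ j′ (*-congˡ t (-‿+-cancelʳ k k′)) ⟨
      t * (d + k′) + j′       ≡⟨ regroup t d k′ j′ ⟩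
      t * k′ + (t * d + j′)   ≈⟨ +-congˡ (t * k′) (+-congʳ j′ t*d≋e) ⟩
      t * k′ + (e + j′)       ≈⟨ +-congˡ (t * k′) (-‿+-cancelʳ j j′) ⟩
      t * k′ + j              ∎
      where
      regroup : ∀ t d k′ j′ → t * (d + k′) + j′ ≡ t * k′ + (t * d + j′)
      regroup = solve-∀

  slope⇒intercept : ∀ {t k k′ j j′} → t * k + j′ ≋ t * k′ + j
                  → ∃ λ c → c + t * k ≋ j × c + t * k′ ≋ j′
  slope⇒intercept {t} {k} {k′} {j} {j′} slope =
    c , -‿+-cancelʳ j (t * k) , +-cancelʳ (t * k) (begin
      c + t * k′ + t * k   ≡⟨ swap c (t * k′) (t * k) ⟩
      c + t * k + t * k′   ≈⟨ +-congʳ (t * k′) (-‿+-cancelʳ j (t * k)) ⟩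
      j + t * k′           ≡⟨ +-comm j (t * k′) ⟩
      t * k′ + j           ≈⟨ slope ⟨
      t * k + j′           ≡⟨ +-comm (t * k) j′ ⟩
      j′ + t * k           ∎)
    where
    open SetoidReasoning ≋-setoid
    c : ℕ
    c = j + - (t * k)
    swap : ∀ x y z → x + y + z ≡ x + z + y
    swap = solve-∀

module _ {n : ℕ} .{{_ : NonZero n}} where
  open Modular n

  ≢⇒≉ : {x y : Fin n} → x ≢ y → ¬ toℕ x ≋ toℕ y
  ≢⇒≉ {x} {y} x≢y x≋y = x≢y (toℕ-injective (≋⇒≡ (toℕ<n x) (toℕ<n y) x≋y))

  ≋⇒mod≡ : ∀ {a} {y : Fin n} → a ≋ toℕ y → a mod n ≡ y
  ≋⇒mod≡ {a} {y} a≋y =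
    toℕ-injective (trans (toℕ-fromℕ< _) (trans a≋y (m<n⇒m%n≡m (toℕ<n y))))

  toℕ-mod-≋ : ∀ a → toℕ (a mod n) ≋ a
  toℕ-mod-≋ a = ≋-trans (≡⇒≋ (toℕ-fromℕ< (m%n<n a n))) (%-≋ a)

  v≁v : ∀ {l k j l′ k′ j′} → ¬ Adj n (v l k j) (v l′ k′ j′)
  v≁v (inj₁ ())
  v≁v (inj₂ ())

  common-neighbour⇒same-column : ∀ {z l k j j′}
                               → Adj n (v l k j) z → Adj n z (v l k j′) → j ≡ j′
  common-neighbour⇒same-column (inj₂ (wv _ _ _ _)) (inj₁ (wv _ _ _ _)) = refl
  common-neighbour⇒same-column (inj₂ (uv _ _ _ _)) (inj₁ (uv _ _ _ _)) = refl
  common-neighbour⇒same-column (inj₂ (sv _ _ _))   (inj₁ (sv _ _ _))   = refl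

  Adj²⇒different-part : ∀ {l k j k′ j′} → Adj² n (v l k j) (v l k′ j′) → k ≢ k′
  Adj²⇒different-part (_   , inj₁ adjacent)             _    = v≁v adjacent
  Adj²⇒different-part (v≢v , inj₂ (_ , adj₁ , adj₂)) refl =
    v≢v (cong (v _ _) (common-neighbour⇒same-column adj₁ adj₂))

  ∃-common-w-neighbour : Prime n → ∀ {k k′ j j′ : Fin n} → k ≢ k′ → j ≢ j′
                       → ∃₂ λ i c → L n i c k ≡ j × L n i c k′ ≡ j′
  ∃-common-w-neighbour p {k} {k′} {j} {j′} k≢k′ j≢j′ =
    w-neighbour (∃-slope p (≢⇒≉ k≢k′) (≢⇒≉ j≢j′))
    where
    w-neighbour : (∃ λ t → 0 < t × t < n × t * toℕ k + toℕ j′ ≋ t * toℕ k′ + toℕ j)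
                → ∃₂ λ i c → L n i c k ≡ j × L n i c k′ ≡ j′
    w-neighbour (suc t , _ , t+1<n , slope)
      with c , on-line₁ , on-line₂ ← slope⇒intercept {suc t} {toℕ k} {toℕ k′} slope =
      i , c mod n , L≡ on-line₁ , L≡ on-line₂
      where
      t<n-1 : t < n ∸ 1
      t<n-1 = ∸-monoˡ-≤ 1 t+1<n
      i : Fin (n ∸ 1)
      i = fromℕ< t<n-1
      L≡ : ∀ {x y} → c + suc t * toℕ x ≋ toℕ y → L n i (c mod n) x ≡ y
      L≡ {x} on-line = ≋⇒mod≡ (≋-trans (+-cong (toℕ-mod-≋ c) slope≡) on-line)
        where
        slope≡ : suc (toℕ i) * toℕ x ≋ suc t * toℕ x
        slope≡ = ≡⇒≋ (cong (λ s → suc s * toℕ x) (toℕ-fromℕ< t<n-1))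

  different-part⇒Adj² : Prime n → ∀ {l k j k′ j′} → k ≢ k′ → Adj² n (v l k j) (v l k′ j′)
  different-part⇒Adj² p {l} {k} {j} {k′} {j′} k≢k′ = v≢v , inj₂ (common-neighbour (j ≟ j′))
    where
    v≢v : v l k j ≢ v l k′ j′
    v≢v refl = k≢k′ refl
    common-neighbour : Dec (j ≡ j′) → ∃ λ z → Adj n (v l k j) z × Adj n z (v l k′ j′)
    common-neighbour (yes refl) = s j , inj₂ (sv j l k) , inj₁ (sv j l k′)
    common-neighbour (no j≢j′) = via-w (∃-common-w-neighbour p k≢k′ j≢j′)
      where
      via-w : (∃₂ λ i c → L n i c k ≡ j × L n i c k′ ≡ j′)
            → ∃ λ z → Adj n (v l k j) z × Adj n z (v l k′ j′)
      via-w (i , c , Lk≡j , Lk′≡j′) =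
        w i c , inj₂ (subst (Edge n (w i c) ∘ v l k) Lk≡j (wv i c k l))
              , inj₁ (subst (Edge n (w i c) ∘ v l k′) Lk′≡j′ (wv i c k′ l))

lemma2p4 : (n : ℕ) .{{_ : NonZero n}} → Prime n → 3 ≤ n → (l : Fin n)
    → (k j k′ j′ : Fin n)
    → Adj² n (v l k j) (v l k′ j′)
    ⇔ CompleteMultipartite {Fin n × Fin n} {Fin n} proj₁ (k , j) (k′ , j′)
lemma2p4 n p _ l k j k′ j′ = mk⇔ Adj²⇒different-part (different-part⇒Adj² p)
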